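{- Fix a positive integer $p$ and let $\lambda,\mu$ be integral partitions all of whose entries are powers of $p$ (i.e. of the form $p^k$ with $k\ge 0$ an integer). Then $\lambda\hookrightarrow\mu$ if and only if $\lambda\preccurlyeq_S\mu$.
   Context: An integral partition is a finite nonincreasing sequence of positive integers. For $\lambda=[\lambda_1,\ldots,\lambda_m]$, $\mu=[\mu_1,\ldots,\mu_n]$, we write $\lambda\hookrightarrow\mu$ if there is a map $\varphi:\{1,\ldots,m\}\to\{1,\ldots,n\}$ with $\sum_{i\in\varphi^{ -1}(j)}\lambda_i\le\mu_j$ for all $j$. We write $\lambda\preccurlyeq_S\mu$ ($\mu$ supermajorizes $\lambda$) if for every $x\in\mathbb{N}$, $\sum_{\lambda_i\ge x}\lambda_i\le\sum_{\mu_j\ge x}\mu_j$. -}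

module Defs where

open import Data.Nat using (ℕ; zero; suc; _+_; _^_; _≤_; _≥_; _<_; _≤?_)
open import Data.List using (List; length; lookup; filter)
open import Data.Nat.ListAction using (sum)
open import Data.List.Relation.Unary.All using (All)
open import Data.Fin using (Fin; _≟_)
import Data.Fin as Fin
open import Data.Fin.Subset using (Subset)
open import Data.Product using (∃; ∃-syntax)
open import Relation.Binary.PropositionalEquality using (_≡_)
open import Data.List.Relation.Unary.Linked using (Linked)
open import Relation.Nullary using (Dec; yes; no)

Nonincreasing : List ℕ → Set
Nonincreasing = Linked _≥_

record IsPartition (l : List ℕ) : Set where
  field
    nonincreasing : Nonincreasing l
    positive      : All (λ a → 1 ≤ a) l

sumFiber : ∀ {m n} → (Fin m → ℕ) → (Fin m → Fin n) → Fin n → ℕ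
sumFiber {zero}  f φ j = 0
sumFiber {suc m} f φ j with φ Fin.zero ≟ j
... | yes _ = f Fin.zero + sumFiber (λ i → f (Fin.suc i)) (λ i → φ (Fin.suc i)) j
... | no  _ = sumFiber (λ i → f (Fin.suc i)) (λ i → φ (Fin.suc i)) j

_↪_ : List ℕ → List ℕ → Set
l ↪ u = ∃[ φ ] (∀ (j : Fin (length u)) → sumFiber {length l} {length u} (lookup l) φ j ≤ lookup u j)

sumGe : ℕ → List ℕ → ℕ
sumGe x l = sum (filter (x ≤?_) l)

_≼S_ : List ℕ → List ℕ → Set
l ≼S u = ∀ (x : ℕ) → sumGe x l ≤ sumGe x u

AllPowersOf : ℕ → List ℕ → Set
AllPowersOf p l = All (λ a → ∃[ k ] a ≡ p ^ k) l

-- Think of λ as items and of μ as bins. With keepGe x e = (e if x ≤ e, else 0),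
-- Σ_{λ_i ≥ x} λ_i = Σ_i keepGe x λ_i. As keepGe x is superadditive, putting an
-- item into a bin never increases Σ_j keepGe x μ_j, hence λ ↪ μ implies λ ≼S μ
-- for arbitrary partitions. Conversely, place the items greedily,
-- largest first, each into any bin with room for it; supermajorization at
-- x = h guarantees such a bin for the largest item h. Every bin stays either an
-- untouched power of p or a multiple of the last item placed, and powers of p
-- below a power of p divide it, so the chosen bin holds a multiple of h. Then
-- for x ≤ h the value keepGe x e drops by exactly h when h is removed from the
-- bin, while for x > h the remaining items contribute nothing: the smaller
-- instance is again supermajorized.
module Submission where

open import Defs
open import Data.Nat using (ℕ; zero; suc; _+_; _*_; _∸_; _^_; _≤_; _<_; _≥_; _≤?_; z≤n; s≤s)
open import Data.Nat.Properties hiding (_≟_)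
open import Data.Nat.Divisibility using (_∣_; ∣-refl; ∣-trans; ∣-reflexive; ∣⇒≤; ∣m+n∣m⇒∣n; m∣m*n)
open import Data.Nat.ListAction using (sum)
open import Data.List using (List; []; _∷_)
import Data.List as L
open import Data.List.Properties using (filter-accept; filter-reject)
open import Data.List.Membership.Propositional.Properties using (∈-lookup)
open import Data.List.Relation.Unary.All using (All; []; _∷_)
import Data.List.Relation.Unary.All as All
open import Data.List.Relation.Unary.AllPairs using (AllPairs; _∷_)
open import Data.List.Relation.Unary.Linked.Properties using (Linked⇒AllPairs)
open import Data.Vec.Functional using (Vector; head; tail; updateAt; foldr)
import Data.Vec.Functional as Vector
open import Data.Vec.Functional.Properties using (updateAt-updates; updateAt-minimal)
open import Data.Fin using (Fin; zero; suc; _≟_)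
open import Data.Product using (_×_; _,_; ∃-syntax)
import Data.Product as Product
open import Data.Sum using (_⊎_; inj₁; inj₂; [_,_]′)
import Data.Sum as Sum
open import Function using (_∘_; id; flip; _⇔_; mk⇔; Equivalence)
open import Relation.Nullary using (yes; no; contradiction)
open import Relation.Binary.PropositionalEquality
open import Algebra.Properties.CommutativeSemigroup +-commutativeSemigroup using (x∙yz≈y∙xz)

keepGe : ℕ → ℕ → ℕ
keepGe x e with x ≤? e
... | yes _ = e
... | no  _ = 0

keepGe-≤ : ∀ x e → keepGe x e ≤ e
keepGe-≤ x e with x ≤? e
... | yes _ = ≤-refl
... | no  _ = z≤n

keepGe-≥ : ∀ {x e} → x ≤ e → keepGe x e ≡ e
keepGe-≥ {x} {e} x≤e with x ≤? e
... | yes _   = refl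
... | no  x≰e = contradiction x≤e x≰e

keepGe-< : ∀ {x e} → e < x → keepGe x e ≡ 0
keepGe-< {x} {e} e<x with x ≤? e
... | yes x≤e = contradiction x≤e (<⇒≱ e<x)
... | no  _   = refl

keepGe-positive : ∀ x {e} → 0 < keepGe x e → x ≤ e
keepGe-positive x {e} pos with x ≤? e
... | yes x≤e = x≤e

keepGe-mono : ∀ x {a b} → a ≤ b → keepGe x a ≤ keepGe x b
keepGe-mono x {a} a≤b with x ≤? a
... | yes x≤a = ≤-trans a≤b (≤-reflexive (sym (keepGe-≥ (≤-trans x≤a a≤b))))
... | no  _   = z≤n

keepGe-superadditive : ∀ x {y e} → y ≤ e → keepGe x y + keepGe x (e ∸ y) ≤ keepGe x e
keepGe-superadditive x {y} {e} y≤e with x ≤? y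
... | no  _   = keepGe-mono x (m∸n≤m e y)
... | yes x≤y = begin
  y + keepGe x (e ∸ y) ≤⟨ +-monoʳ-≤ y (keepGe-≤ x (e ∸ y)) ⟩
  y + (e ∸ y)          ≡⟨ m+[n∸m]≡n y≤e ⟩
  e                    ≡⟨ keepGe-≥ (≤-trans x≤y y≤e) ⟨
  keepGe x e           ∎
  where open ≤-Reasoning

-- A multiple of h is either 0 or at least h.
keepGe-multiple : ∀ {x h} e → x ≤ h → h ∣ e → keepGe x e ≡ e
keepGe-multiple {x} zero    _   _   = n≤0⇒n≡0 (keepGe-≤ x 0)
keepGe-multiple (suc e) x≤h h∣e = keepGe-≥ (≤-trans x≤h (∣⇒≤ h∣e))

sumGe-∷ : ∀ x y l → sumGe x (y ∷ l) ≡ keepGe x y + sumGe x l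
sumGe-∷ x y l with x ≤? y
... | yes x≤y = cong sum (filter-accept (x ≤?_) {xs = l} x≤y)
... | no  x≰y = cong sum (filter-reject (x ≤?_) {xs = l} x≰y)

sumGe-∷-≥ : ∀ {x y} l → x ≤ y → sumGe x (y ∷ l) ≡ y + sumGe x l
sumGe-∷-≥ {x} {y} l x≤y = trans (sumGe-∷ x y l) (cong (_+ sumGe x l) (keepGe-≥ x≤y))

sumGe-bounded : ∀ {h x} l → All (_≤ h) l → h < x → sumGe x l ≡ 0
sumGe-bounded []      []             _   = refl
sumGe-bounded {x = x} (y ∷ l) (y≤h ∷ l≤h) h<x = begin
  sumGe x (y ∷ l)        ≡⟨ sumGe-∷ x y l ⟩
  keepGe x y + sumGe x l ≡⟨ cong₂ _+_ (keepGe-< (≤-<-trans y≤h h<x)) (sumGe-bounded l l≤h h<x) ⟩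
  0                      ∎
  where open ≡-Reasoning

total : ∀ {n} → Vector ℕ n → ℕ
total = foldr _+_ 0

total-positive : ∀ {n} (v : Vector ℕ n) → 0 < total v → ∃[ j ] 0 < v j
total-positive {suc n} v pos with v zero in v₀≡
... | suc _ = zero , subst (0 <_) (sym v₀≡) (s≤s z≤n)
... | zero  = Product.map suc id (total-positive (tail v) pos)

sumGe-total : ∀ x u → sumGe x u ≡ total (keepGe x ∘ L.lookup u)
sumGe-total x []      = refl
sumGe-total x (y ∷ u) = trans (sumGe-∷ x y u) (cong (keepGe x y +_) (sumGe-total x u))

module _ (f : ℕ → ℕ) {g : ℕ → ℕ} {a : ℕ} where

  total-updateAt-≤ : ∀ {n} (c : Vector ℕ n) j → a + f (g (c j)) ≤ f (c j) →
                     a + total (f ∘ updateAt c j g) ≤ total (f ∘ c)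
  total-updateAt-≤ c zero    le = begin
    a + (f (g (c zero)) + total (f ∘ tail c)) ≡⟨ +-assoc a _ _ ⟨
    a + f (g (c zero)) + total (f ∘ tail c)   ≤⟨ +-monoˡ-≤ _ le ⟩
    f (c zero) + total (f ∘ tail c)           ∎
    where open ≤-Reasoning
  total-updateAt-≤ c (suc j) le = begin
    a + (f (c zero) + total (f ∘ updateAt (tail c) j g)) ≡⟨ x∙yz≈y∙xz a (f (c zero)) _ ⟩
    f (c zero) + (a + total (f ∘ updateAt (tail c) j g)) ≤⟨ +-monoʳ-≤ _ (total-updateAt-≤ (tail c) j le) ⟩
    f (c zero) + total (f ∘ tail c)                      ∎
    where open ≤-Reasoning

  total-updateAt-≡ : ∀ {n} (c : Vector ℕ n) j → f (c j) ≡ a + f (g (c j)) →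
                     total (f ∘ c) ≡ a + total (f ∘ updateAt c j g)
  total-updateAt-≡ c zero    eq = trans (cong (_+ total (f ∘ tail c)) eq) (+-assoc a _ _)
  total-updateAt-≡ c (suc j) eq = begin
    f (c zero) + total (f ∘ tail c)                      ≡⟨ cong (f (c zero) +_) (total-updateAt-≡ (tail c) j eq) ⟩
    f (c zero) + (a + total (f ∘ updateAt (tail c) j g)) ≡⟨ x∙yz≈y∙xz (f (c zero)) a _ ⟩
    a + (f (c zero) + total (f ∘ updateAt (tail c) j g)) ∎
    where open ≡-Reasoning

∃-bin-≥ : ∀ x {n} (c : Vector ℕ n) → 0 < total (keepGe x ∘ c) → ∃[ j ] x ≤ c j
∃-bin-≥ x c pos = Product.map₂ (keepGe-positive x) (total-positive (keepGe x ∘ c) pos)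

infix 4 _≤ᵛ_

_≤ᵛ_ : ∀ {n} → Vector ℕ n → Vector ℕ n → Set
a ≤ᵛ c = ∀ k → a k ≤ c k

updateAt-+-≤ᵛ⁻ : ∀ {n} (a c : Vector ℕ n) j {y} → updateAt a j (y +_) ≤ᵛ c →
                 y ≤ c j × a ≤ᵛ updateAt c j (_∸ y)
updateAt-+-≤ᵛ⁻ a c j {y} fits = m+n≤o⇒m≤o y fitsⱼ , fits′
  where
  fitsⱼ : y + a j ≤ c j
  fitsⱼ = subst (_≤ c j) (updateAt-updates j a) (fits j)
  fits′ : a ≤ᵛ updateAt c j (_∸ y)
  fits′ k with k ≟ j
  ... | yes refl = subst₂ _≤_ (m+n∸m≡n y (a k)) (sym (updateAt-updates k c)) (∸-monoˡ-≤ y fitsⱼ)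
  ... | no  k≢j  = subst₂ _≤_ (updateAt-minimal k j a k≢j) (sym (updateAt-minimal k j c k≢j)) (fits k)

updateAt-+-≤ᵛ⁺ : ∀ {n} (a c : Vector ℕ n) j {y} → y ≤ c j → a ≤ᵛ updateAt c j (_∸ y) →
                 updateAt a j (y +_) ≤ᵛ c
updateAt-+-≤ᵛ⁺ a c j {y} y≤cⱼ fits k with k ≟ j
... | no  k≢j  = subst₂ _≤_ (sym (updateAt-minimal k j a k≢j)) (updateAt-minimal k j c k≢j) (fits k)
... | yes refl = begin
  updateAt a k (y +_) k ≡⟨ updateAt-updates k a ⟩
  y + a k               ≤⟨ +-monoʳ-≤ y (subst (a k ≤_) (updateAt-updates k c) (fits k)) ⟩
  y + (c k ∸ y)         ≡⟨ m+[n∸m]≡n y≤cⱼ ⟩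
  c k                   ∎
  where open ≤-Reasoning

sumFiber-∷ : ∀ {m n} (f : Fin (suc m) → ℕ) (φ : Fin (suc m) → Fin n) →
             ∀ k → sumFiber f φ k ≡ updateAt (sumFiber (tail f) (tail φ)) (head φ) (head f +_) k
sumFiber-∷ f φ k with φ zero ≟ k
... | yes refl = sym (updateAt-updates (φ zero) _)
... | no  φ₀≢k = sym (updateAt-minimal k (φ zero) _ (φ₀≢k ∘ sym))

Packs : List ℕ → ∀ {n} → Vector ℕ n → Set
Packs l c = ∃[ φ ] sumFiber (L.lookup l) φ ≤ᵛ c

packs-∷⁻ : ∀ {y l n} {c : Vector ℕ n} → Packs (y ∷ l) c →
           ∃[ j ] y ≤ c j × Packs l (updateAt c j (_∸ y))
packs-∷⁻ {c = c} (φ , fits) with updateAt-+-≤ᵛ⁻ _ c (head φ) (λ k → subst (_≤ c k) (sumFiber-∷ _ φ k) (fits k))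
... | y≤cⱼ , fits′ = head φ , y≤cⱼ , tail φ , fits′

packs-∷⁺ : ∀ {y l n} {c : Vector ℕ n} j → y ≤ c j → Packs l (updateAt c j (_∸ y)) → Packs (y ∷ l) c
packs-∷⁺ {c = c} j y≤cⱼ (ψ , fits) =
  j Vector.∷ ψ , λ k → subst (_≤ c k) (sym (sumFiber-∷ _ (j Vector.∷ ψ) k)) (updateAt-+-≤ᵛ⁺ _ c j y≤cⱼ fits k)

infix 4 _≼ᵛ_

_≼ᵛ_ : List ℕ → ∀ {n} → Vector ℕ n → Set
l ≼ᵛ c = ∀ x → sumGe x l ≤ total (keepGe x ∘ c)

≼S⇔≼ᵛ : ∀ l u → l ≼S u ⇔ l ≼ᵛ L.lookup u
≼S⇔≼ᵛ l u = mk⇔ (λ l≼u x → subst (sumGe x l ≤_) (sumGe-total x u) (l≼u x))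
                 (λ l≼u x → subst (sumGe x l ≤_) (sym (sumGe-total x u)) (l≼u x))

packs⇒≼ᵛ : ∀ l {n} {c : Vector ℕ n} → Packs l c → l ≼ᵛ c
packs⇒≼ᵛ []      _     x = z≤n
packs⇒≼ᵛ (y ∷ l) {c = c} packs x with packs-∷⁻ packs
... | j , y≤cⱼ , packs′ = begin
  sumGe x (y ∷ l)                                     ≡⟨ sumGe-∷ x y l ⟩
  keepGe x y + sumGe x l                              ≤⟨ +-monoʳ-≤ _ (packs⇒≼ᵛ l packs′ x) ⟩
  keepGe x y + total (keepGe x ∘ updateAt c j (_∸ y)) ≤⟨ total-updateAt-≤ (keepGe x) c j (keepGe-superadditive x y≤cⱼ) ⟩
  total (keepGe x ∘ c)                                ∎
  where open ≤-Reasoning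

IsPowerOf : ℕ → ℕ → Set
IsPowerOf p a = ∃[ k ] a ≡ p ^ k

power-positive : ∀ {p a} → 1 ≤ p → IsPowerOf p a → 0 < a
power-positive {suc q} _ (k , refl) = m^n>0 (suc q) k

^-monoʳ-∣ : ∀ p {i j} → i ≤ j → p ^ i ∣ p ^ j
^-monoʳ-∣ p {i} {j} i≤j = subst (p ^ i ∣_) (begin
  p ^ i * p ^ (j ∸ i) ≡⟨ ^-distribˡ-+-* p i (j ∸ i) ⟨
  p ^ (i + (j ∸ i))   ≡⟨ cong (p ^_) (m+[n∸m]≡n i≤j) ⟩
  p ^ j               ∎) (m∣m*n (p ^ (j ∸ i)))
  where open ≡-Reasoning

power-∣ : ∀ {p a b} → 1 ≤ p → IsPowerOf p a → IsPowerOf p b → a ≤ b → a ∣ b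
power-∣ {suc q} _ (i , refl) (j , refl) pⁱ≤pʲ with ≤-total i j
... | inj₁ i≤j = ^-monoʳ-∣ (suc q) i≤j
... | inj₂ j≤i = ∣-reflexive (≤-antisym pⁱ≤pʲ (∣⇒≤ {{m^n≢0 (suc q) i}} (^-monoʳ-∣ (suc q) j≤i)))

≼ᵛ-remove-largest : ∀ {h} l {n} (c : Vector ℕ n) j → All (_≤ h) l → h ≤ c j → h ∣ c j ∸ h →
                    h ∷ l ≼ᵛ c → l ≼ᵛ updateAt c j (_∸ h)
≼ᵛ-remove-largest {h} l c j l≤h h≤cⱼ h∣cⱼ∸h hl≼c x with x ≤? h
... | no  x≰h = subst (_≤ total (keepGe x ∘ updateAt c j (_∸ h))) (sym (sumGe-bounded l l≤h (≰⇒> x≰h))) z≤n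
... | yes x≤h = +-cancelˡ-≤ h _ _ (begin
  h + sumGe x l                                  ≡⟨ sumGe-∷-≥ l x≤h ⟨
  sumGe x (h ∷ l)                                ≤⟨ hl≼c x ⟩
  total (keepGe x ∘ c)                           ≡⟨ total-updateAt-≡ (keepGe x) c j keepGe-cⱼ ⟩
  h + total (keepGe x ∘ updateAt c j (_∸ h))     ∎)
  where
  open ≤-Reasoning
  keepGe-cⱼ : keepGe x (c j) ≡ h + keepGe x (c j ∸ h)
  keepGe-cⱼ = begin-equality
    keepGe x (c j)         ≡⟨ keepGe-≥ (≤-trans x≤h h≤cⱼ) ⟩
    c j                    ≡⟨ m+[n∸m]≡n h≤cⱼ ⟨
    h + (c j ∸ h)          ≡⟨ cong (h +_) (keepGe-multiple (c j ∸ h) x≤h h∣cⱼ∸h) ⟨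
    h + keepGe x (c j ∸ h) ∎

greedy : ∀ {p} → 1 ≤ p → ∀ l → AllPairs _≥_ l → All (IsPowerOf p) l →
         ∀ {n} (c : Vector ℕ n) → (∀ k → IsPowerOf p (c k) ⊎ All (_∣ c k) l) →
         l ≼ᵛ c → Packs l c
greedy p≥1 []      _ _ c _ _ = (λ ()) , λ _ → z≤n
greedy {p} p≥1 (h ∷ l) (l≤h ∷ sorted) (h-pow ∷ l-pow) {n} c bins l≼c =
  packs-∷⁺ j h≤cⱼ (greedy p≥1 l sorted l-pow c′ bins′ (≼ᵛ-remove-largest l c j l≤h h≤cⱼ h∣cⱼ∸h l≼c))
  where
  h≤sum : h ≤ total (keepGe h ∘ c)
  h≤sum = ≤-trans (subst (h ≤_) (sym (sumGe-∷-≥ l ≤-refl)) (m≤m+n h _)) (l≼c h)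
  bin : ∃[ j ] h ≤ c j
  bin = ∃-bin-≥ h c (<-≤-trans (power-positive p≥1 h-pow) h≤sum)
  j : Fin n
  j = Product.proj₁ bin
  h≤cⱼ : h ≤ c j
  h≤cⱼ = Product.proj₂ bin
  c′ : Vector ℕ n
  c′ = updateAt c j (_∸ h)
  l∣h : All (_∣ h) l
  l∣h = All.zipWith (λ (y-pow , y≤h) → power-∣ p≥1 y-pow h-pow y≤h) (l-pow , l≤h)
  h∣cⱼ : h ∣ c j
  h∣cⱼ = [ (λ cⱼ-pow → power-∣ p≥1 h-pow cⱼ-pow h≤cⱼ) , All.head ]′ (bins j)
  h∣cⱼ∸h : h ∣ c j ∸ h
  h∣cⱼ∸h = ∣m+n∣m⇒∣n (subst (h ∣_) (sym (m+[n∸m]≡n h≤cⱼ)) h∣cⱼ) ∣-refl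
  bins′ : ∀ k → IsPowerOf p (c′ k) ⊎ All (_∣ c′ k) l
  bins′ k with k ≟ j
  ... | yes refl = inj₂ (subst (λ e → All (_∣ e) l) (sym (updateAt-updates j c))
                               (All.map (λ y∣h → ∣-trans y∣h h∣cⱼ∸h) l∣h))
  ... | no  k≢j  = subst (λ e → IsPowerOf p e ⊎ All (_∣ e) l) (sym (updateAt-minimal k j c k≢j))
                         (Sum.map₂ All.tail (bins k))

theorem3p2 : (p : ℕ) → 1 ≤ p → (l u : List ℕ) →
    IsPartition l → IsPartition u → AllPowersOf p l → AllPowersOf p u →
    ((l ↪ u → l ≼S u) × (l ≼S u → l ↪ u))
theorem3p2 p p≥1 l u l-partition _ l-pow u-pow = ↪⇒≼S , ≼S⇒↪
  where
  ↪⇒≼S : l ↪ u → l ≼S u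
  ↪⇒≼S l↪u = Equivalence.from (≼S⇔≼ᵛ l u) (packs⇒≼ᵛ l l↪u)
  ≼S⇒↪ : l ≼S u → l ↪ u
  ≼S⇒↪ l≼u = greedy p≥1 l (Linked⇒AllPairs (flip ≤-trans) (IsPartition.nonincreasing l-partition)) l-pow
    (L.lookup u) (λ k → inj₁ (All.lookup u-pow (∈-lookup k))) (Equivalence.to (≼S⇔≼ᵛ l u) l≼u)
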